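{- Let $O=(0,0,0)$. The set of all equilateral triangles with vertices in $\mathbb{Z}^3$, one vertex equal to $O$ and the other two lying in the plane $\{(\alpha,\beta,\gamma):\alpha+5\beta+11\gamma=0\}$ equals $$\{\,\{O,(8m-9n,\,5m+4n,\,-3m-n),\,(-m-8n,\,9m-5n,\,-4m+3n)\} : m,n\in\mathbb{Z},\ (m,n)\neq(0,0)\,\},$$ and the triangle corresponding to $(m,n)$ has side length $7\sqrt{2(m^2-mn+n^2)}$.
   Context: Triangles are regarded as unordered sets of three vertices. -}

module Defs where

open import Data.Integer using (ℤ; _+_; _-_; _*_; -_; +_)
open import Data.Product using (_×_; _,_; ∃₂)
open import Data.Sum using (_⊎_)
open import Relation.Binary.PropositionalEquality using (_≡_; _≢_)
open import Relation.Nullary using (¬_)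

Point : Set
Point = ℤ × ℤ × ℤ

O : Point
O = (+ 0 , + 0 , + 0)

dist² : Point → Point → ℤ
dist² (x₁ , y₁ , z₁) (x₂ , y₂ , z₂) =
  (x₁ - x₂) * (x₁ - x₂) + (y₁ - y₂) * (y₁ - y₂) + (z₁ - z₂) * (z₁ - z₂)

InPlane : Point → Set
InPlane (α , β , γ) = α + + 5 * β + + 11 * γ ≡ + 0

_∈₃_ : Point → Point × Point × Point → Set
X ∈₃ (a , b , c) = X ≡ a ⊎ X ≡ b ⊎ X ≡ c

-- two triangles are equal iff they have the same vertex set
SameTriangle : Point × Point × Point → Point × Point × Point → Set
SameTriangle t u = ∀ X → (X ∈₃ t → X ∈₃ u) × (X ∈₃ u → X ∈₃ t)

IsEquilateral : Point × Point × Point → Set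
IsEquilateral (a , b , c) =
  a ≢ b × b ≢ c × a ≢ c × dist² a b ≡ dist² b c × dist² b c ≡ dist² a c

OneVertexOOthersInPlane : Point × Point × Point → Set
OneVertexOOthersInPlane (a , b , c) =
    (a ≡ O × InPlane b × InPlane c)
  ⊎ (b ≡ O × InPlane a × InPlane c)
  ⊎ (c ≡ O × InPlane a × InPlane b)

P : ℤ → ℤ → Point
P m n = (+ 8 * m - + 9 * n , + 5 * m + + 4 * n , - (+ 3 * m) - n)

Q : ℤ → ℤ → Point
Q m n = (- m - + 8 * n , + 9 * m - + 5 * n , - (+ 4 * m) + + 3 * n)

T : ℤ → ℤ → Point × Point × Point
T m n = (O , P m n , Q m n)

NonZeroPair : ℤ → ℤ → Set
NonZeroPair m n = ¬ (m ≡ + 0 × n ≡ + 0)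

{-# OPTIONS --safe #-}
-- In the coordinates (β, γ) of the plane, dist² O is the binary form N = 26β² + 110βγ + 122γ² of
-- determinant 147 = 3·7², with polar form S, so N(x) N(y) = S(x,y)² + 147 det(x,y)². For an equilateral
-- triangle O x y the cosine rule gives 2S = N, hence N = ±14 det. The identity
-- N(x) y = S(x,y) x + det(x,y) J x, with J x = (1,5,11) × x, then yields 14 y = 7 x ± J x: y is x
-- turned by ±60° about the normal of the plane. Integrality of the turn forces 7 ∣ β + 4γ, which says
-- that x = P m n, and the turn of P m n is Q m n.
module Submission where

open import Defs
open import Data.Integer using (ℤ; _+_; _-_; _*_; +_; -_; -[1+_]; 0ℤ; ∣_∣)
open import Data.Integer.Base using (≢-nonZero)
open import Data.Integer.Properties
  using ( +-injective; pos-+; pos-*; ∣i∣≡0⇒i≡0; i≡j⇒i-j≡0; i-j≡0⇒i≡j; i*j≡0⇒i≡0∨j≡0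
        ; *-cancelˡ-≡; *-assoc; neg-involutive)
open import Data.Integer.Tactic.RingSolver using (solve-∀; solve)
open import Data.List using (_∷_; [])
open import Data.Nat as ℕ using (ℕ)
open import Data.Nat.Properties using (m+n≡0⇒m≡0; m+n≡0⇒n≡0; m*n≡0⇒m≡0∨n≡0)
open import Data.Empty using (⊥; ⊥-elim)
open import Data.Product using (_×_; _,_; ∃; ∃₂; proj₁; proj₂)
open import Data.Sum as Sum using (_⊎_; inj₁; inj₂; [_,_]; reduce; swap; map₁; map₂; assocˡ; assocʳ)
open import Function using (id; _∘_)
open import Relation.Binary.PropositionalEquality
  using (_≡_; _≢_; refl; sym; trans; cong; cong₂; subst₂; ≢-sym; module ≡-Reasoning)
open ≡-Reasoning

square≡∣∣² : ∀ i → i * i ≡ + (∣ i ∣ ℕ.* ∣ i ∣)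
square≡∣∣² (+ n)    = sym (pos-* n n)
square≡∣∣² -[1+ n ] = refl

∣∣²≡0⇒≡0 : ∀ i → ∣ i ∣ ℕ.* ∣ i ∣ ≡ 0 → i ≡ 0ℤ
∣∣²≡0⇒≡0 i h = ∣i∣≡0⇒i≡0 (reduce (m*n≡0⇒m≡0∨n≡0 ∣ i ∣ h))

sum-of-squares≡0 : ∀ x y z → x * x + y * y + z * z ≡ 0ℤ → x ≡ 0ℤ × y ≡ 0ℤ × z ≡ 0ℤ
sum-of-squares≡0 x y z h =
    ∣∣²≡0⇒≡0 x (m+n≡0⇒m≡0 a (m+n≡0⇒m≡0 (a ℕ.+ b) a+b+c≡0))
  , ∣∣²≡0⇒≡0 y (m+n≡0⇒n≡0 a (m+n≡0⇒m≡0 (a ℕ.+ b) a+b+c≡0))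
  , ∣∣²≡0⇒≡0 z (m+n≡0⇒n≡0 (a ℕ.+ b) a+b+c≡0)
  where
  a b c : ℕ
  a = ∣ x ∣ ℕ.* ∣ x ∣
  b = ∣ y ∣ ℕ.* ∣ y ∣
  c = ∣ z ∣ ℕ.* ∣ z ∣
  a+b+c≡0 : a ℕ.+ b ℕ.+ c ≡ 0
  a+b+c≡0 = +-injective (begin
    + (a ℕ.+ b ℕ.+ c)    ≡⟨ pos-+ (a ℕ.+ b) c ⟩
    + (a ℕ.+ b) + + c    ≡⟨ cong (_+ + c) (pos-+ a b) ⟩
    + a + + b + + c      ≡⟨ sym (cong₂ _+_ (cong₂ _+_ (square≡∣∣² x) (square≡∣∣² y)) (square≡∣∣² z)) ⟩
    x * x + y * y + z * z ≡⟨ h ⟩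
    0ℤ                   ∎)

i≡i+i-j⇒j≡i : ∀ i j → i ≡ i + i - j → j ≡ i
i≡i+i-j⇒j≡i i j h = begin
  j               ≡⟨ solve (i ∷ j ∷ []) ⟩
  i + i - (i + i - j) ≡⟨ cong (λ k → i + i - k) (sym h) ⟩
  i + i - i       ≡⟨ solve (i ∷ []) ⟩
  i               ∎

norm≡±14det : ∀ N S d → + 2 * S ≡ N → N * N ≡ S * S + + 147 * (d * d) →
              N ≡ + 14 * d ⊎ N ≡ - (+ 14 * d)
norm≡±14det _ S d refl h with i*j≡0⇒i≡0∨j≡0 (+ 3) 3[N-14d][N+14d]≡0
  where
  3[N-14d][N+14d]≡0 : + 3 * ((+ 2 * S - + 14 * d) * (+ 2 * S + + 14 * d)) ≡ 0ℤ
  3[N-14d][N+14d]≡0 = begin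
    + 3 * ((+ 2 * S - + 14 * d) * (+ 2 * S + + 14 * d))
      ≡⟨ solve (S ∷ d ∷ []) ⟩
    + 4 * ((+ 2 * S) * (+ 2 * S) - (S * S + + 147 * (d * d)))
      ≡⟨ cong (+ 4 *_) (i≡j⇒i-j≡0 h) ⟩
    0ℤ ∎
... | inj₂ e with i*j≡0⇒i≡0∨j≡0 (+ 2 * S - + 14 * d) e
...   | inj₁ e₁ = inj₁ (i-j≡0⇒i≡j _ _ e₁)
...   | inj₂ e₂ = inj₂ (i-j≡0⇒i≡j _ _ (trans (cong (_+_ (+ 2 * S)) (neg-involutive (+ 14 * d))) e₂))

N*u≡S*v+d*w⇒14u≡7v+w : ∀ {N S d u v w} → N ≢ 0ℤ → N ≡ + 14 * d → + 2 * S ≡ N →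
                N * u ≡ S * v + d * w → + 14 * u ≡ + 7 * v + w
N*u≡S*v+d*w⇒14u≡7v+w {S = S} {d} {u} {v} {w} N≢0 refl 2S≡N h =
  *-cancelˡ-≡ d _ _ {{≢-nonZero d≢0}} (begin
    d * (+ 14 * u)       ≡⟨ solve (d ∷ u ∷ []) ⟩
    + 14 * d * u         ≡⟨ h ⟩
    S * v + d * w        ≡⟨ cong (λ s → s * v + d * w) S≡7d ⟩
    + 7 * d * v + d * w  ≡⟨ solve (d ∷ v ∷ w ∷ []) ⟩
    d * (+ 7 * v + w)    ∎)
  where
  d≢0 : d ≢ 0ℤ
  d≢0 refl = N≢0 refl
  S≡7d : S ≡ + 7 * d
  S≡7d = *-cancelˡ-≡ (+ 2) _ _ (trans 2S≡N (*-assoc (+ 2) (+ 7) d))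

dist²-sym : ∀ X Y → dist² X Y ≡ dist² Y X
dist²-sym (x₁ , x₂ , x₃) (y₁ , y₂ , y₃) =
  cong₂ _+_ (cong₂ _+_ ([i-j]²≡[j-i]² x₁ y₁) ([i-j]²≡[j-i]² x₂ y₂)) ([i-j]²≡[j-i]² x₃ y₃)
  where
  [i-j]²≡[j-i]² : ∀ i j → (i - j) * (i - j) ≡ (j - i) * (j - i)
  [i-j]²≡[j-i]² i j = solve (i ∷ j ∷ [])

dist²-self : ∀ X → dist² X X ≡ 0ℤ
dist²-self (x₁ , x₂ , x₃) = cong₂ _+_ (cong₂ _+_ ([i-i]²≡0 x₁) ([i-i]²≡0 x₂)) ([i-i]²≡0 x₃)
  where
  [i-i]²≡0 : ∀ i → (i - i) * (i - i) ≡ 0ℤ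
  [i-i]²≡0 i = solve (i ∷ [])

dist²≡0⇒≡ : ∀ X Y → dist² X Y ≡ 0ℤ → X ≡ Y
dist²≡0⇒≡ (x₁ , x₂ , x₃) (y₁ , y₂ , y₃) h
  with sum-of-squares≡0 (x₁ - y₁) (x₂ - y₂) (x₃ - y₃) h
... | e₁ , e₂ , e₃ =
  cong₂ _,_ (i-j≡0⇒i≡j _ _ e₁) (cong₂ _,_ (i-j≡0⇒i≡j _ _ e₂) (i-j≡0⇒i≡j _ _ e₃))

dist²≢0⇒≢ : ∀ {X Y L} → dist² X Y ≡ L → L ≢ 0ℤ → X ≢ Y
dist²≢0⇒≢ {X} d≡L L≢0 refl = L≢0 (trans (sym d≡L) (dist²-self X))

Triangle : Set
Triangle = Point × Point × Point

sameTriangle-trans : ∀ {t u v : Triangle} → SameTriangle t u → SameTriangle u v → SameTriangle t v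
sameTriangle-trans t≈u u≈v X = proj₁ (u≈v X) ∘ proj₁ (t≈u X) , proj₂ (t≈u X) ∘ proj₂ (u≈v X)

≡⇒sameTriangle : ∀ {t u : Triangle} → t ≡ u → SameTriangle t u
≡⇒sameTriangle refl X = id , id

sameTriangle-swap₁₂ : ∀ {a b c} → SameTriangle (a , b , c) (b , a , c)
sameTriangle-swap₁₂ X = swap₁₂ , swap₁₂
  where
  swap₁₂ : ∀ {A B C : Set} → A ⊎ B ⊎ C → B ⊎ A ⊎ C
  swap₁₂ = assocʳ ∘ map₁ swap ∘ assocˡ

sameTriangle-swap₂₃ : ∀ {a b c} → SameTriangle (a , b , c) (a , c , b)
sameTriangle-swap₂₃ X = map₂ swap , map₂ swap

isEquilateral-swap₁₂ : ∀ {a b c} → IsEquilateral (a , b , c) → IsEquilateral (b , a , c)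
isEquilateral-swap₁₂ {a} {b} (a≢b , b≢c , a≢c , ab≡bc , bc≡ac) =
  ≢-sym a≢b , a≢c , b≢c , trans (dist²-sym b a) (trans ab≡bc bc≡ac) , sym bc≡ac

isEquilateral-swap₂₃ : ∀ {a b c} → IsEquilateral (a , b , c) → IsEquilateral (a , c , b)
isEquilateral-swap₂₃ {a} {b} {c} (a≢b , b≢c , a≢c , ab≡bc , bc≡ac) =
  a≢c , ≢-sym b≢c , a≢b , trans (sym bc≡ac) (dist²-sym b c) , trans (dist²-sym c b) (sym ab≡bc)

no-three-distinct-in-pair : ∀ {x y z a b : Point} → x ≢ y → y ≢ z → x ≢ z →
                            x ≡ a ⊎ x ≡ b → y ≡ a ⊎ y ≡ b → z ≡ a ⊎ z ≡ b → ⊥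
no-three-distinct-in-pair x≢y _   _   (inj₁ refl) (inj₁ refl) _           = x≢y refl
no-three-distinct-in-pair _   _   x≢z (inj₁ refl) (inj₂ refl) (inj₁ refl) = x≢z refl
no-three-distinct-in-pair _   y≢z _   (inj₁ refl) (inj₂ refl) (inj₂ refl) = y≢z refl
no-three-distinct-in-pair _   y≢z _   (inj₂ refl) (inj₁ refl) (inj₁ refl) = y≢z refl
no-three-distinct-in-pair _   _   x≢z (inj₂ refl) (inj₁ refl) (inj₂ refl) = x≢z refl
no-three-distinct-in-pair x≢y _   _   (inj₂ refl) (inj₂ refl) _           = x≢y refl

vertices-distinct : ∀ {x y z a b c} → x ≢ y → y ≢ z → x ≢ z →
                    x ∈₃ (a , b , c) → y ∈₃ (a , b , c) → z ∈₃ (a , b , c) →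
                    a ≢ b × b ≢ c × a ≢ c
vertices-distinct {a = a} {b} {c} x≢y y≢z x≢z x∈ y∈ z∈ =
    (λ { refl → pigeonhole [ inj₁ , id ] })
  , (λ { refl → pigeonhole (map₂ reduce) })
  , (λ { refl → pigeonhole [ inj₁ , swap ] })
  where
  pigeonhole : ∀ {p q} → (∀ {w} → w ∈₃ (a , b , c) → w ≡ p ⊎ w ≡ q) → ⊥
  pigeonhole merge = no-three-distinct-in-pair x≢y y≢z x≢z (merge x∈) (merge y∈) (merge z∈)

planePoint : ℤ → ℤ → Point
planePoint β γ = (- (+ 5 * β) - + 11 * γ , β , γ)

inPlane⇒≡planePoint : ∀ {α β γ} → InPlane (α , β , γ) → (α , β , γ) ≡ planePoint β γ
inPlane⇒≡planePoint {α} {β} {γ} h = cong (_, β , γ) (begin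
  α                                           ≡⟨ solve (α ∷ β ∷ γ ∷ []) ⟩
  α + + 5 * β + + 11 * γ - + 11 * γ - + 5 * β ≡⟨ cong (λ s → s - + 11 * γ - + 5 * β) h ⟩
  0ℤ - + 11 * γ - + 5 * β                     ≡⟨ solve (β ∷ γ ∷ []) ⟩
  - (+ 5 * β) - + 11 * γ                      ∎)

norm : ℤ → ℤ → ℤ
norm β γ = + 26 * β * β + + 110 * β * γ + + 122 * γ * γ

inner : ℤ → ℤ → ℤ → ℤ → ℤ
inner β γ β' γ' = + 26 * β * β' + + 55 * (β * γ' + γ * β') + + 122 * γ * γ'

det : ℤ → ℤ → ℤ → ℤ → ℤ
det β γ β' γ' = β * γ' - γ * β'

-- Inlined so that the ring solver, which does not unfold definitions, sees the polynomials.
{-# INLINE norm #-}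
{-# INLINE inner #-}
{-# INLINE det #-}

dist²-planePoint : ∀ β γ β' γ' → dist² (planePoint β γ) (planePoint β' γ') ≡ norm (β - β') (γ - γ')
dist²-planePoint = coordinatewise
  where
  -- dist² is not unfolded by the solver, so its unfolding is spelled out.
  coordinatewise : ∀ β γ β' γ' →
    (- (+ 5 * β) - + 11 * γ - (- (+ 5 * β') - + 11 * γ')) * (- (+ 5 * β) - + 11 * γ - (- (+ 5 * β') - + 11 * γ'))
      + (β - β') * (β - β') + (γ - γ') * (γ - γ') ≡ norm (β - β') (γ - γ')
  coordinatewise = solve-∀

norm-diff : ∀ β γ β' γ' → norm (β - β') (γ - γ') ≡ norm β γ + norm β' γ' - + 2 * inner β γ β' γ'
norm-diff = solve-∀

dist²-O-planePoint : ∀ β γ → dist² O (planePoint β γ) ≡ norm β γ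
dist²-O-planePoint β γ = trans (dist²-planePoint 0ℤ 0ℤ β γ) (solve (β ∷ γ ∷ []))

norm*norm : ∀ β γ β' γ' →
  norm β γ * norm β' γ' ≡ inner β γ β' γ' * inner β γ β' γ' + + 147 * (det β γ β' γ' * det β γ β' γ')
norm*norm = solve-∀

norm*β' : ∀ β γ β' γ' →
  norm β γ * β' ≡ inner β γ β' γ' * β + det β γ β' γ' * (- (+ 55 * β) - + 122 * γ)
norm*β' = solve-∀

norm*γ' : ∀ β γ β' γ' →
  norm β γ * γ' ≡ inner β γ β' γ' * γ + det β γ β' γ' * (+ 26 * β + + 55 * γ)
norm*γ' = solve-∀

inner-sym : ∀ β γ β' γ' → inner β' γ' β γ ≡ inner β γ β' γ'
inner-sym = solve-∀

-14det≡14det-swap : ∀ β γ β' γ' → - (+ 14 * det β γ β' γ') ≡ + 14 * det β' γ' β γ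
-14det≡14det-swap = solve-∀

-- (−55β − 122γ, 26β + 55γ) are the β, γ coordinates of (1, 5, 11) × planePoint β γ. As
-- |(1, 5, 11)| = 7√3, this says that planePoint β' γ' is planePoint β γ turned by 60° about (1, 5, 11).
IsRotation60 : ℤ → ℤ → ℤ → ℤ → Set
IsRotation60 β γ β' γ' =
  + 14 * β' ≡ + 7 * β + (- (+ 55 * β) - + 122 * γ) × + 14 * γ' ≡ + 7 * γ + (+ 26 * β + + 55 * γ)

rotation60-from-det : ∀ β γ β' γ' → norm β γ ≢ 0ℤ → norm β γ ≡ + 14 * det β γ β' γ' →
                      + 2 * inner β γ β' γ' ≡ norm β γ → IsRotation60 β γ β' γ'
rotation60-from-det β γ β' γ' N≢0 N≡14d 2S≡N =
    N*u≡S*v+d*w⇒14u≡7v+w N≢0 N≡14d 2S≡N (norm*β' β γ β' γ')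
  , N*u≡S*v+d*w⇒14u≡7v+w N≢0 N≡14d 2S≡N (norm*γ' β γ β' γ')

equilateral⇒rotation60 : ∀ β γ β' γ' → IsEquilateral (O , planePoint β γ , planePoint β' γ') →
                         IsRotation60 β γ β' γ' ⊎ IsRotation60 β' γ' β γ
equilateral⇒rotation60 β γ β' γ' (O≢X , _ , _ , OX≡XY , XY≡OY) =
  Sum.map turn turn-back (norm≡±14det N S d 2S≡N N²≡S²+147d²)
  where
  N N' S d : ℤ
  N = norm β γ
  N' = norm β' γ'
  S = inner β γ β' γ'
  d = det β γ β' γ'
  N≢0 : N ≢ 0ℤ
  N≢0 N≡0 = O≢X (dist²≡0⇒≡ O (planePoint β γ) (trans (dist²-O-planePoint β γ) N≡0))
  N≡N' : N ≡ N'
  N≡N' = begin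
    N                           ≡⟨ sym (dist²-O-planePoint β γ) ⟩
    dist² O (planePoint β γ)    ≡⟨ trans OX≡XY XY≡OY ⟩
    dist² O (planePoint β' γ')  ≡⟨ dist²-O-planePoint β' γ' ⟩
    N'                          ∎
  2S≡N : + 2 * S ≡ N
  2S≡N = i≡i+i-j⇒j≡i N (+ 2 * S) (begin
    N                                          ≡⟨ sym (dist²-O-planePoint β γ) ⟩
    dist² O (planePoint β γ)                   ≡⟨ OX≡XY ⟩
    dist² (planePoint β γ) (planePoint β' γ')  ≡⟨ dist²-planePoint β γ β' γ' ⟩
    norm (β - β') (γ - γ')                     ≡⟨ norm-diff β γ β' γ' ⟩
    N + N' - + 2 * S                           ≡⟨ cong (λ k → N + k - + 2 * S) (sym N≡N') ⟩
    N + N - + 2 * S                            ∎)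
  N²≡S²+147d² : N * N ≡ S * S + + 147 * (d * d)
  N²≡S²+147d² = trans (cong (N *_) N≡N') (norm*norm β γ β' γ')
  turn : N ≡ + 14 * d → IsRotation60 β γ β' γ'
  turn N≡14d = rotation60-from-det β γ β' γ' N≢0 N≡14d 2S≡N
  turn-back : N ≡ - (+ 14 * d) → IsRotation60 β' γ' β γ
  turn-back N≡-14d = rotation60-from-det β' γ' β γ
    (N≢0 ∘ trans N≡N')
    (trans (sym N≡N') (trans N≡-14d (-14det≡14det-swap β γ β' γ')))
    (trans (cong (+ 2 *_) (inner-sym β γ β' γ')) (trans 2S≡N N≡N'))

P-lattice : ∀ {β γ m} → β + + 4 * γ ≡ - (+ 7 * m) → ∃ λ n → β ≡ + 5 * m + + 4 * n × γ ≡ - (+ 3 * m) - n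
P-lattice {β} {γ} {m} h = - (+ 3 * m) - γ , (begin
    β                        ≡⟨ solve (β ∷ γ ∷ []) ⟩
    β + + 4 * γ - + 4 * γ    ≡⟨ cong (λ s → s - + 4 * γ) h ⟩
    - (+ 7 * m) - + 4 * γ    ≡⟨ solve (m ∷ γ ∷ []) ⟩
    + 5 * m + + 4 * (- (+ 3 * m) - γ) ∎)
  , solve (m ∷ γ ∷ [])

-- Inverting P gives m = −(β + 4γ)/7, which by 7β' = −24β − 61γ is the integer 17β + 43γ + 5β'.
rotation60-domain : ∀ {β γ β' γ'} → IsRotation60 β γ β' γ' →
                    ∃₂ λ m n → β ≡ + 5 * m + + 4 * n × γ ≡ - (+ 3 * m) - n
rotation60-domain {β} {γ} {β'} (hβ , _) = m , P-lattice {β} {γ} {m} (*-cancelˡ-≡ (+ 2) _ _ (begin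
  + 2 * (β + + 4 * γ)
    ≡⟨ solve (β ∷ γ ∷ []) ⟩
  - (+ 5 * (+ 7 * β + (- (+ 55 * β) - + 122 * γ)) + + 14 * (+ 17 * β + + 43 * γ))
    ≡⟨ cong (λ u → - (+ 5 * u + + 14 * (+ 17 * β + + 43 * γ))) (sym hβ) ⟩
  - (+ 5 * (+ 14 * β') + + 14 * (+ 17 * β + + 43 * γ))
    ≡⟨ solve (β ∷ γ ∷ β' ∷ []) ⟩
  + 2 * - (+ 7 * (+ 17 * β + + 43 * γ + + 5 * β')) ∎))
  where
  m : ℤ
  m = + 17 * β + + 43 * γ + + 5 * β'

rotation60-of-P : ∀ m n {β' γ'} → IsRotation60 (+ 5 * m + + 4 * n) (- (+ 3 * m) - n) β' γ' →
                  β' ≡ + 9 * m - + 5 * n × γ' ≡ - (+ 4 * m) + + 3 * n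
rotation60-of-P m n (hβ , hγ) =
    *-cancelˡ-≡ (+ 14) _ _ (trans hβ (solve (m ∷ n ∷ [])))
  , *-cancelˡ-≡ (+ 14) _ _ (trans hγ (solve (m ∷ n ∷ [])))

P-inPlane : ∀ m n → InPlane (P m n)
P-inPlane = coordinatewise
  where
  coordinatewise : ∀ m n → + 8 * m - + 9 * n + + 5 * (+ 5 * m + + 4 * n) + + 11 * (- (+ 3 * m) - n) ≡ 0ℤ
  coordinatewise = solve-∀

Q-inPlane : ∀ m n → InPlane (Q m n)
Q-inPlane = coordinatewise
  where
  coordinatewise : ∀ m n → - m - + 8 * n + + 5 * (+ 9 * m - + 5 * n) + + 11 * (- (+ 4 * m) + + 3 * n) ≡ 0ℤ
  coordinatewise = solve-∀

P≡planePoint : ∀ m n → P m n ≡ planePoint (+ 5 * m + + 4 * n) (- (+ 3 * m) - n)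
P≡planePoint m n = inPlane⇒≡planePoint (P-inPlane m n)

Q≡planePoint : ∀ m n → Q m n ≡ planePoint (+ 9 * m - + 5 * n) (- (+ 4 * m) + + 3 * n)
Q≡planePoint m n = inPlane⇒≡planePoint (Q-inPlane m n)

rotation60⇒P,Q : ∀ {β γ β' γ'} → IsRotation60 β γ β' γ' →
                 ∃₂ λ m n → planePoint β γ ≡ P m n × planePoint β' γ' ≡ Q m n
rotation60⇒P,Q {β} {γ} {β'} {γ'} rot =
  let m , n , β≡ , γ≡ = rotation60-domain {β} {γ} {β'} {γ'} rot
      β'≡ , γ'≡ = rotation60-of-P m n (subst₂ (λ b c → IsRotation60 b c β' γ') β≡ γ≡ rot)
  in  m , n , trans (cong₂ planePoint β≡ γ≡) (sym (P≡planePoint m n))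
            , trans (cong₂ planePoint β'≡ γ'≡) (sym (Q≡planePoint m n))

side² : ℤ → ℤ → ℤ
side² m n = + 49 * (+ 2 * (m * m - m * n + n * n))

{-# INLINE side² #-}

dist²-O-P : ∀ m n → dist² O (P m n) ≡ side² m n
dist²-O-P m n = begin
  dist² O (P m n)
    ≡⟨ cong (dist² O) (P≡planePoint m n) ⟩
  dist² O (planePoint (+ 5 * m + + 4 * n) (- (+ 3 * m) - n))
    ≡⟨ dist²-O-planePoint (+ 5 * m + + 4 * n) (- (+ 3 * m) - n) ⟩
  norm (+ 5 * m + + 4 * n) (- (+ 3 * m) - n)
    ≡⟨ solve (m ∷ n ∷ []) ⟩
  side² m n
    ∎

dist²-O-Q : ∀ m n → dist² O (Q m n) ≡ side² m n
dist²-O-Q m n = begin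
  dist² O (Q m n)
    ≡⟨ cong (dist² O) (Q≡planePoint m n) ⟩
  dist² O (planePoint (+ 9 * m - + 5 * n) (- (+ 4 * m) + + 3 * n))
    ≡⟨ dist²-O-planePoint (+ 9 * m - + 5 * n) (- (+ 4 * m) + + 3 * n) ⟩
  norm (+ 9 * m - + 5 * n) (- (+ 4 * m) + + 3 * n)
    ≡⟨ solve (m ∷ n ∷ []) ⟩
  side² m n
    ∎

dist²-P-Q : ∀ m n → dist² (P m n) (Q m n) ≡ side² m n
dist²-P-Q m n = begin
  dist² (P m n) (Q m n)
    ≡⟨ cong₂ dist² (P≡planePoint m n) (Q≡planePoint m n) ⟩
  dist² (planePoint (+ 5 * m + + 4 * n) (- (+ 3 * m) - n))
        (planePoint (+ 9 * m - + 5 * n) (- (+ 4 * m) + + 3 * n))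
    ≡⟨ dist²-planePoint (+ 5 * m + + 4 * n) (- (+ 3 * m) - n) (+ 9 * m - + 5 * n) (- (+ 4 * m) + + 3 * n) ⟩
  norm (+ 5 * m + + 4 * n - (+ 9 * m - + 5 * n)) (- (+ 3 * m) - n - (- (+ 4 * m) + + 3 * n))
    ≡⟨ solve (m ∷ n ∷ []) ⟩
  side² m n
    ∎

side²≢0 : ∀ {m n} → NonZeroPair m n → side² m n ≢ 0ℤ
side²≢0 {m} {n} nz side²≡0 =
  let m≡0 , n≡0 , _ = sum-of-squares≡0 m n (m - n)
                        ([ (λ ()) , id ] (i*j≡0⇒i≡0∨j≡0 (+ 49) 49[m²+n²+[m-n]²]≡0))
  in  nz (m≡0 , n≡0)
  where
  49[m²+n²+[m-n]²]≡0 : + 49 * (m * m + n * n + (m - n) * (m - n)) ≡ 0ℤ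
  49[m²+n²+[m-n]²]≡0 = begin
    + 49 * (m * m + n * n + (m - n) * (m - n)) ≡⟨ solve (m ∷ n ∷ []) ⟩
    side² m n                                  ≡⟨ side²≡0 ⟩
    0ℤ                                         ∎

module _ (m n : ℤ) where

  T-inPlane : ∀ {X} → X ∈₃ T m n → InPlane X
  T-inPlane (inj₁ refl)        = refl
  T-inPlane (inj₂ (inj₁ refl)) = P-inPlane m n
  T-inPlane (inj₂ (inj₂ refl)) = Q-inPlane m n

  T-side : ∀ {X Y} → X ∈₃ T m n → Y ∈₃ T m n → X ≢ Y → dist² X Y ≡ side² m n
  T-side (inj₁ refl)        (inj₁ refl)        X≢Y = ⊥-elim (X≢Y refl)
  T-side (inj₁ refl)        (inj₂ (inj₁ refl)) _   = dist²-O-P m n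
  T-side (inj₁ refl)        (inj₂ (inj₂ refl)) _   = dist²-O-Q m n
  T-side (inj₂ (inj₁ refl)) (inj₁ refl)        _   = trans (dist²-sym (P m n) O) (dist²-O-P m n)
  T-side (inj₂ (inj₁ refl)) (inj₂ (inj₁ refl)) X≢Y = ⊥-elim (X≢Y refl)
  T-side (inj₂ (inj₁ refl)) (inj₂ (inj₂ refl)) _   = dist²-P-Q m n
  T-side (inj₂ (inj₂ refl)) (inj₁ refl)        _   = trans (dist²-sym (Q m n) O) (dist²-O-Q m n)
  T-side (inj₂ (inj₂ refl)) (inj₂ (inj₁ refl)) _   = trans (dist²-sym (Q m n) (P m n)) (dist²-P-Q m n)
  T-side (inj₂ (inj₂ refl)) (inj₂ (inj₂ refl)) X≢Y = ⊥-elim (X≢Y refl)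

  T-distinct : NonZeroPair m n → O ≢ P m n × P m n ≢ Q m n × O ≢ Q m n
  T-distinct nz =
      dist²≢0⇒≢ (dist²-O-P m n) (side²≢0 nz)
    , dist²≢0⇒≢ (dist²-P-Q m n) (side²≢0 nz)
    , dist²≢0⇒≢ (dist²-O-Q m n) (side²≢0 nz)

O-vertex : ∀ {a b c} → O ∈₃ (a , b , c) → InPlane a → InPlane b → InPlane c →
           OneVertexOOthersInPlane (a , b , c)
O-vertex (inj₁ refl)        _  pb pc = inj₁ (refl , pb , pc)
O-vertex (inj₂ (inj₁ refl)) pa _  pc = inj₂ (inj₁ (refl , pa , pc))
O-vertex (inj₂ (inj₂ refl)) pa pb _  = inj₂ (inj₂ (refl , pa , pb))

Parametrised : Triangle → Set
Parametrised t = ∃₂ λ m n → NonZeroPair m n × SameTriangle t (T m n)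

parametrised-resp : ∀ {t u} → SameTriangle t u → Parametrised u → Parametrised t
parametrised-resp t≈u (m , n , nz , u≈T) = m , n , nz , sameTriangle-trans t≈u u≈T

parametrised-O : ∀ {X Y m n} → O ≢ X → X ≡ P m n → Y ≡ Q m n → Parametrised (O , X , Y)
parametrised-O {m = m} {n} O≢X X≡P Y≡Q =
  m , n , (λ { (refl , refl) → O≢X (sym X≡P) }) , ≡⇒sameTriangle (cong₂ (λ X Y → O , X , Y) X≡P Y≡Q)

parametrised-turn : ∀ β γ β' γ' → O ≢ planePoint β γ → IsRotation60 β γ β' γ' →
                    Parametrised (O , planePoint β γ , planePoint β' γ')
parametrised-turn β γ β' γ' O≢X rot =
  let m , n , X≡P , Y≡Q = rotation60⇒P,Q {β} {γ} {β'} {γ'} rot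
  in  parametrised-O {planePoint β γ} {planePoint β' γ'} {m} {n} O≢X X≡P Y≡Q

forward-planePoints : ∀ β γ β' γ' → IsEquilateral (O , planePoint β γ , planePoint β' γ') →
                      Parametrised (O , planePoint β γ , planePoint β' γ')
forward-planePoints β γ β' γ' eq@(O≢X , _ , O≢Y , _) =
  [ (parametrised-turn β γ β' γ' O≢X)
  , (parametrised-resp sameTriangle-swap₂₃ ∘ parametrised-turn β' γ' β γ O≢Y)
  ] (equilateral⇒rotation60 β γ β' γ' eq)

forward-O : ∀ {X Y} → InPlane X → InPlane Y → IsEquilateral (O , X , Y) → Parametrised (O , X , Y)
forward-O {α , β , γ} {α' , β' , γ'} pX pY =
  subst₂ (λ X Y → IsEquilateral (O , X , Y) → Parametrised (O , X , Y))
         (sym (inPlane⇒≡planePoint {α} {β} {γ} pX)) (sym (inPlane⇒≡planePoint {α'} {β'} {γ'} pY))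
         (forward-planePoints β γ β' γ')

forward : ∀ t → IsEquilateral t × OneVertexOOthersInPlane t → Parametrised t
forward _ (eq , inj₁ (refl , pb , pc))        = forward-O pb pc eq
forward _ (eq , inj₂ (inj₁ (refl , pa , pc))) =
  parametrised-resp sameTriangle-swap₁₂ (forward-O pa pc (isEquilateral-swap₁₂ eq))
forward _ (eq , inj₂ (inj₂ (refl , pa , pb))) =
  parametrised-resp (sameTriangle-trans sameTriangle-swap₂₃ sameTriangle-swap₁₂)
                    (forward-O pa pb (isEquilateral-swap₁₂ (isEquilateral-swap₂₃ eq)))

backward : ∀ t → Parametrised t → IsEquilateral t × OneVertexOOthersInPlane t
backward (a , b , c) (m , n , nz , t≈T) =
  let a≢b , b≢c , a≢c = distinct
  in  ( a≢b , b≢c , a≢c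
      , trans (T-side m n a∈ b∈ a≢b) (sym (T-side m n b∈ c∈ b≢c))
      , trans (T-side m n b∈ c∈ b≢c) (sym (T-side m n a∈ c∈ a≢c)))
    , O-vertex (proj₂ (t≈T O) (inj₁ refl)) (T-inPlane m n a∈) (T-inPlane m n b∈) (T-inPlane m n c∈)
  where
  a∈ : a ∈₃ T m n
  a∈ = proj₁ (t≈T a) (inj₁ refl)
  b∈ : b ∈₃ T m n
  b∈ = proj₁ (t≈T b) (inj₂ (inj₁ refl))
  c∈ : c ∈₃ T m n
  c∈ = proj₁ (t≈T c) (inj₂ (inj₂ refl))
  distinct : a ≢ b × b ≢ c × a ≢ c
  distinct =
    let O≢P , P≢Q , O≢Q = T-distinct m n nz
    in  vertices-distinct O≢P P≢Q O≢Q (proj₂ (t≈T O) (inj₁ refl))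
          (proj₂ (t≈T (P m n)) (inj₂ (inj₁ refl))) (proj₂ (t≈T (Q m n)) (inj₂ (inj₂ refl)))

mainTheorem10 :
    ((t : Point × Point × Point) →
        ((IsEquilateral t × OneVertexOOthersInPlane t) →
          ∃₂ λ m n → NonZeroPair m n × SameTriangle t (T m n))
      × ((∃₂ λ m n → NonZeroPair m n × SameTriangle t (T m n)) →
          IsEquilateral t × OneVertexOOthersInPlane t))
    × ((m n : ℤ) → NonZeroPair m n →
        dist² O (P m n) ≡ + 49 * (+ 2 * (m * m - m * n + n * n))
          × dist² (P m n) (Q m n) ≡ + 49 * (+ 2 * (m * m - m * n + n * n))
          × dist² O (Q m n) ≡ + 49 * (+ 2 * (m * m - m * n + n * n)))
mainTheorem10 = (λ t → forward t , backward t) , λ m n _ → dist²-O-P m n , dist²-P-Q m n , dist²-O-Q m n
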